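{- Let $n\ge2$ and $k\ge1$ be integers, and let $G_n$ be the clique extension of the first kind of the path $P_n$ (vertices $v_1,\dots,v_n$ in order) with clique sizes $(a_1,\dots,a_n)=(k+3,k+1,k+1,\dots,k+1,k+3)$. Then all real roots of the polynomial $U_{G_n}(x)$ are positive, and the minimal positive root equals $1/(k+4)$.
   Context: Clique extension of the first kind: for a graph $G$ with vertex set $\{v_1,\dots,v_n\}$ and positive integers $a_1,\dots,a_n$, glue to each $v_i$ a complete graph $K_{a_i}$ on $a_i$ vertices (pairwise disjoint cliques, $K_{a_i}$ meeting $G$ only in $v_i$). The monovariate signed independence polynomial of a graph $F$ is $U_F(x)=\sum_I(-x)^{|I|}$, summed over all independent sets $I$ of $F$ (including the empty set). -}

module Defs where

open import Level using (0ℓ)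
open import Data.Bool using (Bool; true; false; _∧_; _∨_; not)
open import Data.Nat as ℕ using (ℕ; zero; suc; _≡ᵇ_; _∸_)
open import Data.Fin using (Fin; toℕ; zero; suc)
open import Data.Sum using (_⊎_; inj₁; inj₂)
open import Data.Product using (Σ; _,_; _×_; ∃)
open import Data.List using (List; []; _∷_; map; concatMap; length; foldr)
open import Data.List using (allFin)
open import Relation.Binary using (Rel; IsTotalOrder)
open import Relation.Nullary using (¬_)
open import Algebra.Bundles using (CommutativeRing)

record OrderedField : Set₁ where
  field
    commutativeRing : CommutativeRing 0ℓ 0ℓ
  open CommutativeRing commutativeRing public
  field
    _≤_          : Rel Carrier 0ℓ
    isTotalOrder : IsTotalOrder _≈_ _≤_
    0≉1          : ¬ (0# ≈ 1#)
    inverse      : ∀ x → ¬ (x ≈ 0#) → ∃ λ y → x * y ≈ 1#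
    +-mono-≤     : ∀ {x y} z → x ≤ y → (x + z) ≤ (y + z)
    *-nonneg     : ∀ {x y} → 0# ≤ x → 0# ≤ y → 0# ≤ (x * y)

  _<_ : Rel Carrier 0ℓ
  x < y = (x ≤ y) × ¬ (x ≈ y)

  pow : Carrier → ℕ → Carrier
  pow x zero    = 1#
  pow x (suc n) = x * pow x n

  fromℕ : ℕ → Carrier
  fromℕ zero    = 0#
  fromℕ (suc n) = 1# + fromℕ n

  sumF : List Carrier → Carrier
  sumF = foldr _+_ 0#

-- Finite simple graphs: a vertex type, a list enumerating every vertex
-- exactly once, and a (symmetric, irreflexive) Boolean adjacency.

record Graph : Set₁ where
  field
    V        : Set
    vertices : List V
    adj      : V → V → Bool

-- all sublists of a list (= all subsets, when the list has no repetitions)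
sublists : {A : Set} → List A → List (List A)
sublists []       = [] ∷ []
sublists (x ∷ xs) = let r = sublists xs in r Data.List.++ map (x ∷_) r

allB : {A : Set} → (A → Bool) → List A → Bool
allB p []       = true
allB p (x ∷ xs) = p x ∧ allB p xs

independent : (G : Graph) → List (Graph.V G) → Bool
independent G S = allB (λ u → allB (λ w → not (Graph.adj G u w)) S) S

independentSets : (G : Graph) → List (List (Graph.V G))
independentSets G = Data.List.filterᵇ (independent G) (sublists (Graph.vertices G))

U : (F : OrderedField) (G : Graph) → OrderedField.Carrier F → OrderedField.Carrier F
U F G x = sumF (map (λ I → pow (- x) (length I)) (independentSets G))
  where open OrderedField F

-- Path P_n on vertices v_1,…,v_n, represented by Fin n (v_{i+1} = i).

pathAdj : (n : ℕ) → Fin n → Fin n → Bool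
pathAdj n i j = (suc (toℕ i) ≡ᵇ toℕ j) ∨ (suc (toℕ j) ≡ᵇ toℕ i)

-- Clique extension of the first kind of a graph on Fin n with clique
-- sizes a_i ≥ 1.  Vertices: inj₁ i is v_i, and inj₂ (i , p) are the
-- a_i − 1 new vertices of the clique K_{a_i} glued at v_i.
cliqueExt : (n : ℕ) → (Fin n → Fin n → Bool) → (Fin n → ℕ) → Graph
cliqueExt n gadj a = record
  { V        = Fin n ⊎ Σ (Fin n) (λ i → Fin (a i ∸ 1))
  ; vertices = map inj₁ (allFin n)
               Data.List.++ concatMap (λ i → map (λ p → inj₂ (i , p)) (allFin (a i ∸ 1))) (allFin n)
  ; adj      = ad
  }
  where
  ad : Fin n ⊎ Σ (Fin n) (λ i → Fin (a i ∸ 1)) → Fin n ⊎ Σ (Fin n) (λ i → Fin (a i ∸ 1)) → Bool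
  ad (inj₁ i)       (inj₁ j)       = gadj i j
  ad (inj₁ i)       (inj₂ (j , q)) = toℕ i ≡ᵇ toℕ j
  ad (inj₂ (i , p)) (inj₁ j)       = toℕ i ≡ᵇ toℕ j
  ad (inj₂ (i , p)) (inj₂ (j , q)) = (toℕ i ≡ᵇ toℕ j) ∧ not (toℕ p ≡ᵇ toℕ q)

sizesG : (n k : ℕ) → Fin n → ℕ
sizesG n k i with (toℕ i ≡ᵇ 0) ∨ (suc (toℕ i) ≡ᵇ n)
... | true  = k ℕ.+ 3
... | false = k ℕ.+ 1

Gn : (n k : ℕ) → Graph
Gn n k = cliqueExt n (pathAdj n) (sizesG n k)

-- Eliminating the vertices of G_n in the order v₁, K₁, v₂, K₂, … turns U_{G_n}(x)
-- into a two-term recurrence along the path: with t = −x and α(s) = 1 + (s − 1) t,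
--   P(s ∷ ss) = α(s) P(ss) + t Q(ss),   Q(s ∷ ss) = α(s) P(ss),
-- where Q is P with the first path vertex deleted.  For x ≤ 0 every term is
-- positive.  For x > 0 put D = 1 − (k + 4) x and E = 2P − Q: along the sizes
-- k+1, …, k+1, k+3 one finds P = (D + 2x) P′ + x E′ and E = D P′ + 2x E′, with
-- E = D on the last vertex, and finally U = D P′ + x E′.  So D = 0 forces U = 0,
-- while 0 < x < 1/(k + 4) makes D, hence P, E and U, positive.
module Submission where

open import Level using (Level)
open import Data.Bool using (Bool; true; false; T; T?; _∧_; not; if_then_else_)
open import Data.Bool.Properties using (∧-zeroʳ; ∧-identityʳ; ∧-comm; ∧-assoc; ∧-commutativeMonoid)
import Data.Nat as Nat
open Nat using (ℕ; zero; suc; _∸_; _≡ᵇ_; s≤s; z≤n)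
open import Data.Nat.Properties using (_≟_; 1+n≢n; <⇒≢; <⇒≤; m<n⇒m<1+n; ≤-reflexive)
import Data.Nat.Properties as ℕₚ
open import Data.Fin using (Fin; toℕ; zero; suc)
import Data.Fin as Fin
open import Data.Fin.Properties using (toℕ-injective; toℕ-fromℕ)
open import Data.Sum using (inj₁; inj₂)
open import Data.Product using (_×_; _,_; proj₁; proj₂)
open import Data.Maybe using (Maybe; just; nothing)
open import Data.Empty using (⊥-elim)
open import Data.List
  using (List; []; _∷_; [_]; _++_; replicate; length; map; filterᵇ; concatMap; tabulate; allFin)
open import Data.List.Properties
  using (filter-++; map-++; filter-≐; length-map; length-tabulate; map-tabulate)
open import Data.List.Relation.Unary.All as All using (All; []; _∷_)
open import Data.List.Relation.Unary.All.Properties using (map⁺; ++⁺)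
open import Data.List.Relation.Unary.AllPairs as AllPairs using (AllPairs; []; _∷_)
import Data.List.Relation.Unary.AllPairs.Properties as AllPairs
open import Data.List.Relation.Unary.Unique.Propositional.Properties using (allFin⁺)
open import Data.List.Relation.Binary.Permutation.Propositional
  using (_↭_; prep; swap) renaming (refl to ↭-refl; trans to ↭-trans)
open import Data.List.Relation.Binary.Permutation.Propositional.Properties using (shifts; ++⁺ˡ)
open import Function using (_∘_; id)
open import Relation.Nullary using (¬_; yes; no)
open import Relation.Nullary.Decidable using (dec-true; dec-false)
open import Relation.Unary using (_≐_)
open import Relation.Binary.PropositionalEquality as ≡ using (_≡_; _≢_; ≢-sym; cong; cong₂)
open import Relation.Binary.Structures using (IsTotalOrder)
open import Algebra.Bundles using (CommutativeRing; CommutativeMonoid; RawRing)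
open import Algebra.Properties.CommutativeSemigroup (CommutativeMonoid.commutativeSemigroup ∧-commutativeMonoid)
  using () renaming (xy∙z≈xz∙y to ∧-xy∙z≈xz∙y; interchange to ∧-interchange)
import Algebra.Properties.Ring
import Algebra.Properties.AbelianGroup
import Algebra.Properties.CommutativeSemigroup
import Algebra.Solver.Ring
import Algebra.Solver.Ring.AlmostCommutativeRing as ACR
import Relation.Binary.Reasoning.Setoid as SetoidReasoning

open import Defs

≡ᵇ-true : ∀ m → (m ≡ᵇ m) ≡ true
≡ᵇ-true m = dec-true (m ≟ m) ≡.refl

≡ᵇ-false : ∀ {m n} → m ≢ n → (m ≡ᵇ n) ≡ false
≡ᵇ-false {m} {n} = dec-false (m ≟ n)

allB-∧ : ∀ {A : Set} (p q : A → Bool) xs → allB (λ u → p u ∧ q u) xs ≡ allB p xs ∧ allB q xs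
allB-∧ p q []       = ≡.refl
allB-∧ p q (x ∷ xs) = ≡.trans (cong ((p x ∧ q x) ∧_) (allB-∧ p q xs)) (∧-interchange (p x) (q x) _ _)

allB-true : ∀ {A : Set} (xs : List A) → allB (λ _ → true) xs ≡ true
allB-true []       = ≡.refl
allB-true (x ∷ xs) = allB-true xs

tabulate-replicate-∷ʳ : ∀ {A : Set} {c e : A} m (f : Fin (suc m) → A) →
                        (∀ j → toℕ j Nat.< m → f j ≡ c) → f (Fin.fromℕ m) ≡ e →
                        tabulate f ≡ replicate m c ++ [ e ]
tabulate-replicate-∷ʳ zero    f inner last = cong [_] last
tabulate-replicate-∷ʳ (suc m) f inner last =
  cong₂ _∷_ (inner zero (s≤s z≤n))
            (tabulate-replicate-∷ʳ m (f ∘ suc) (λ j j<m → inner (suc j) (s≤s j<m)) last)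

-- Algebra.Solver.Ring instantiated with integer coefficients, so that it proves
-- identities in every commutative ring; an integer is a pair (a , b) of naturals
-- read as a − b.
module IntegerCoefficientSolver {c ℓ : Level} (R : CommutativeRing c ℓ) where
  open CommutativeRing R hiding (zero)
  open Algebra.Properties.Ring ring using (-‿distribˡ-*; -‿distribʳ-*)
  open Algebra.Properties.AbelianGroup +-abelianGroup using (⁻¹-∙-comm; ⁻¹-involutive; ε⁻¹≈ε)
  open Algebra.Properties.CommutativeSemigroup +-commutativeSemigroup using (interchange)
  open SetoidReasoning setoid

  private
    -- Without a trailing 0#, so that the literals 1 and 2 denote 1# and 1# + 1#.
    ⟦_⟧ℕ : ℕ → Carrier
    ⟦ zero ⟧ℕ        = 0#
    ⟦ suc zero ⟧ℕ    = 1#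
    ⟦ suc (suc m) ⟧ℕ = 1# + ⟦ suc m ⟧ℕ

    ⟦suc⟧ : ∀ m → ⟦ suc m ⟧ℕ ≈ 1# + ⟦ m ⟧ℕ
    ⟦suc⟧ zero    = sym (+-identityʳ 1#)
    ⟦suc⟧ (suc m) = refl

    ⟦+⟧ : ∀ a b → ⟦ a Nat.+ b ⟧ℕ ≈ ⟦ a ⟧ℕ + ⟦ b ⟧ℕ
    ⟦+⟧ zero    b = sym (+-identityˡ _)
    ⟦+⟧ (suc a) b = begin
      ⟦ suc (a Nat.+ b) ⟧ℕ      ≈⟨ ⟦suc⟧ (a Nat.+ b) ⟩
      1# + ⟦ a Nat.+ b ⟧ℕ       ≈⟨ +-congˡ (⟦+⟧ a b) ⟩
      1# + (⟦ a ⟧ℕ + ⟦ b ⟧ℕ)    ≈⟨ +-assoc _ _ _ ⟨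
      (1# + ⟦ a ⟧ℕ) + ⟦ b ⟧ℕ    ≈⟨ +-congʳ (⟦suc⟧ a) ⟨
      ⟦ suc a ⟧ℕ + ⟦ b ⟧ℕ       ∎

    ⟦*⟧ : ∀ a b → ⟦ a Nat.* b ⟧ℕ ≈ ⟦ a ⟧ℕ * ⟦ b ⟧ℕ
    ⟦*⟧ zero    b = sym (zeroˡ _)
    ⟦*⟧ (suc a) b = begin
      ⟦ b Nat.+ a Nat.* b ⟧ℕ           ≈⟨ ⟦+⟧ b (a Nat.* b) ⟩
      ⟦ b ⟧ℕ + ⟦ a Nat.* b ⟧ℕ          ≈⟨ +-cong (sym (*-identityˡ _)) (⟦*⟧ a b) ⟩
      1# * ⟦ b ⟧ℕ + ⟦ a ⟧ℕ * ⟦ b ⟧ℕ   ≈⟨ distribʳ _ _ _ ⟨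
      (1# + ⟦ a ⟧ℕ) * ⟦ b ⟧ℕ          ≈⟨ *-congʳ (⟦suc⟧ a) ⟨
      ⟦ suc a ⟧ℕ * ⟦ b ⟧ℕ             ∎

    diff-+ : ∀ a b c d → (a - b) + (c - d) ≈ (a + c) - (b + d)
    diff-+ a b c d = trans (interchange a (- b) c (- d)) (+-congˡ (⁻¹-∙-comm b d))

    diff-* : ∀ a b c d → (a - b) * (c - d) ≈ (a * c + b * d) - (a * d + b * c)
    diff-* a b c d = begin
      (a - b) * (c - d)                           ≈⟨ distribʳ _ _ _ ⟩
      a * (c - d) + - b * (c - d)                 ≈⟨ +-cong (distribˡ _ _ _) (distribˡ _ _ _) ⟩
      (a * c + a * - d) + (- b * c + - b * - d)   ≈⟨ +-cong (+-congˡ (sym (-‿distribʳ-* a d)))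
                                                            (+-cong (sym (-‿distribˡ-* b c)) neg*neg) ⟩
      (a * c + - (a * d)) + (- (b * c) + b * d)   ≈⟨ +-congˡ (+-comm _ _) ⟩
      (a * c + - (a * d)) + (b * d + - (b * c))   ≈⟨ interchange _ _ _ _ ⟩
      (a * c + b * d) + (- (a * d) + - (b * c))   ≈⟨ +-congˡ (⁻¹-∙-comm _ _) ⟩
      (a * c + b * d) - (a * d + b * c)           ∎
      where
      neg*neg : - b * - d ≈ b * d
      neg*neg = trans (sym (-‿distribˡ-* b (- d))) (trans (-‿cong (sym (-‿distribʳ-* b d))) (⁻¹-involutive _))

    diff-cancel : ∀ a b c d → a + d ≈ b + c → a - b ≈ c - d
    diff-cancel a b c d a+d≈b+c = begin
      a - b               ≈⟨ +-congʳ (+-identityʳ a) ⟨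
      (a + 0#) - b        ≈⟨ +-congʳ (+-congˡ (-‿inverseʳ d)) ⟨
      (a + (d - d)) - b   ≈⟨ +-congʳ (+-assoc _ _ _) ⟨
      ((a + d) - d) - b   ≈⟨ +-congʳ (+-congʳ a+d≈b+c) ⟩
      ((b + c) - d) - b   ≈⟨ +-congʳ (trans (+-assoc _ _ _) (+-comm _ _)) ⟩
      ((c - d) + b) - b   ≈⟨ +-assoc _ _ _ ⟩
      (c - d) + (b - b)   ≈⟨ +-congˡ (-‿inverseʳ b) ⟩
      (c - d) + 0#        ≈⟨ +-identityʳ _ ⟩
      c - d               ∎

    -- Canonical representatives make equal integer coefficients syntactically
    -- equal, which the solver's final reflexivity step relies on.
    canon : ℕ × ℕ → ℕ × ℕ
    canon (suc a , suc b) = canon (a , b)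
    canon ab              = ab

    ⟦_⟧ : ℕ × ℕ → Carrier
    ⟦ a , zero ⟧  = ⟦ a ⟧ℕ
    ⟦ a , suc b ⟧ = ⟦ a ⟧ℕ - ⟦ suc b ⟧ℕ

    ⟦⟧-diff : ∀ a b → ⟦ a , b ⟧ ≈ ⟦ a ⟧ℕ - ⟦ b ⟧ℕ
    ⟦⟧-diff a zero    = trans (sym (+-identityʳ _)) (+-congˡ (sym ε⁻¹≈ε))
    ⟦⟧-diff a (suc b) = refl

    ⟦canon⟧ : ∀ a b → ⟦ canon (a , b) ⟧ ≈ ⟦ a ⟧ℕ - ⟦ b ⟧ℕ
    ⟦canon⟧ zero    b       = ⟦⟧-diff zero b
    ⟦canon⟧ (suc a) zero    = ⟦⟧-diff (suc a) zero
    ⟦canon⟧ (suc a) (suc b) = begin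
      ⟦ canon (a , b) ⟧                  ≈⟨ ⟦canon⟧ a b ⟩
      ⟦ a ⟧ℕ - ⟦ b ⟧ℕ                     ≈⟨ +-identityˡ _ ⟨
      0# + (⟦ a ⟧ℕ - ⟦ b ⟧ℕ)              ≈⟨ +-congʳ (-‿inverseʳ 1#) ⟨
      (1# - 1#) + (⟦ a ⟧ℕ - ⟦ b ⟧ℕ)       ≈⟨ diff-+ 1# 1# _ _ ⟩
      (1# + ⟦ a ⟧ℕ) - (1# + ⟦ b ⟧ℕ)       ≈⟨ +-cong (⟦suc⟧ a) (-‿cong (⟦suc⟧ b)) ⟨
      ⟦ suc a ⟧ℕ - ⟦ suc b ⟧ℕ             ∎

    ℤ-raw : RawRing _ _
    ℤ-raw = record
      { Carrier = ℕ × ℕ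
      ; _≈_     = _≡_
      ; _+_     = λ { (a , b) (c , d) → canon (a Nat.+ c , b Nat.+ d) }
      ; _*_     = λ { (a , b) (c , d) → canon (a Nat.* c Nat.+ b Nat.* d , a Nat.* d Nat.+ b Nat.* c) }
      ; -_      = λ { (a , b) → (b , a) }
      ; 0#      = (0 , 0)
      ; 1#      = (1 , 0)
      }

    +-homo : ∀ a b c d → ⟦ canon (a Nat.+ c , b Nat.+ d) ⟧ ≈ ⟦ a , b ⟧ + ⟦ c , d ⟧
    +-homo a b c d = begin
      ⟦ canon (a Nat.+ c , b Nat.+ d) ⟧          ≈⟨ ⟦canon⟧ (a Nat.+ c) (b Nat.+ d) ⟩
      ⟦ a Nat.+ c ⟧ℕ - ⟦ b Nat.+ d ⟧ℕ            ≈⟨ +-cong (⟦+⟧ a c) (-‿cong (⟦+⟧ b d)) ⟩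
      (⟦ a ⟧ℕ + ⟦ c ⟧ℕ) - (⟦ b ⟧ℕ + ⟦ d ⟧ℕ)      ≈⟨ diff-+ _ _ _ _ ⟨
      (⟦ a ⟧ℕ - ⟦ b ⟧ℕ) + (⟦ c ⟧ℕ - ⟦ d ⟧ℕ)      ≈⟨ +-cong (⟦⟧-diff a b) (⟦⟧-diff c d) ⟨
      ⟦ a , b ⟧ + ⟦ c , d ⟧                      ∎

    *-homo : ∀ a b c d →
             ⟦ canon (a Nat.* c Nat.+ b Nat.* d , a Nat.* d Nat.+ b Nat.* c) ⟧ ≈ ⟦ a , b ⟧ * ⟦ c , d ⟧
    *-homo a b c d = begin
      ⟦ canon (a Nat.* c Nat.+ b Nat.* d , a Nat.* d Nat.+ b Nat.* c) ⟧
        ≈⟨ ⟦canon⟧ (a Nat.* c Nat.+ b Nat.* d) (a Nat.* d Nat.+ b Nat.* c) ⟩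
      ⟦ a Nat.* c Nat.+ b Nat.* d ⟧ℕ - ⟦ a Nat.* d Nat.+ b Nat.* c ⟧ℕ
        ≈⟨ +-cong (⟦+*⟧ a c b d) (-‿cong (⟦+*⟧ a d b c)) ⟩
      (A * C + B * D) - (A * D + B * C)
        ≈⟨ diff-* _ _ _ _ ⟨
      (A - B) * (C - D)
        ≈⟨ *-cong (⟦⟧-diff a b) (⟦⟧-diff c d) ⟨
      ⟦ a , b ⟧ * ⟦ c , d ⟧ ∎
      where
      A = ⟦ a ⟧ℕ; B = ⟦ b ⟧ℕ; C = ⟦ c ⟧ℕ; D = ⟦ d ⟧ℕ
      ⟦+*⟧ : ∀ p q r s → ⟦ p Nat.* q Nat.+ r Nat.* s ⟧ℕ ≈ ⟦ p ⟧ℕ * ⟦ q ⟧ℕ + ⟦ r ⟧ℕ * ⟦ s ⟧ℕ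
      ⟦+*⟧ p q r s = trans (⟦+⟧ (p Nat.* q) (r Nat.* s)) (+-cong (⟦*⟧ p q) (⟦*⟧ r s))

    -‿homo : ∀ a b → ⟦ b , a ⟧ ≈ - ⟦ a , b ⟧
    -‿homo a b = begin
      ⟦ b , a ⟧                ≈⟨ ⟦⟧-diff b a ⟩
      ⟦ b ⟧ℕ - ⟦ a ⟧ℕ          ≈⟨ +-comm _ _ ⟩
      - ⟦ a ⟧ℕ + ⟦ b ⟧ℕ        ≈⟨ +-congˡ (⁻¹-involutive _) ⟨
      - ⟦ a ⟧ℕ - - ⟦ b ⟧ℕ      ≈⟨ ⁻¹-∙-comm _ _ ⟩
      - (⟦ a ⟧ℕ - ⟦ b ⟧ℕ)      ≈⟨ -‿cong (⟦⟧-diff a b) ⟨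
      - ⟦ a , b ⟧              ∎

    R′ : ACR.AlmostCommutativeRing _ _
    R′ = ACR.fromCommutativeRing R

    homomorphism : ℤ-raw ACR.-Raw-AlmostCommutative⟶ R′
    homomorphism = record
      { ⟦_⟧    = ⟦_⟧
      ; +-homo = λ { (a , b) (c , d) → +-homo a b c d }
      ; *-homo = λ { (a , b) (c , d) → *-homo a b c d }
      ; -‿homo = λ { (a , b) → -‿homo a b }
      ; 0-homo = refl
      ; 1-homo = refl
      }

    equal? : ∀ x y → Maybe (⟦ x ⟧ ≈ ⟦ y ⟧)
    equal? (a , b) (c , d) with a Nat.+ d ≟ b Nat.+ c
    ... | no _  = nothing
    ... | yes e = just (begin
      ⟦ a , b ⟧          ≈⟨ ⟦⟧-diff a b ⟩
      ⟦ a ⟧ℕ - ⟦ b ⟧ℕ    ≈⟨ diff-cancel _ _ _ _ a+d≈b+c ⟩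
      ⟦ c ⟧ℕ - ⟦ d ⟧ℕ    ≈⟨ ⟦⟧-diff c d ⟨
      ⟦ c , d ⟧          ∎)
      where
      a+d≈b+c : ⟦ a ⟧ℕ + ⟦ d ⟧ℕ ≈ ⟦ b ⟧ℕ + ⟦ c ⟧ℕ
      a+d≈b+c = trans (sym (⟦+⟧ a d)) (trans (reflexive (cong ⟦_⟧ℕ e)) (⟦+⟧ b c))

  open Algebra.Solver.Ring ℤ-raw R′ homomorphism equal? public
    using (solve; _:=_; _:+_; _:*_; :-_; _:-_; con; Polynomial)

  lit : ∀ {v} → ℕ → Polynomial v
  lit m = con (m , 0)

module OrderedFieldProperties (F : OrderedField) where
  open OrderedField F hiding (zero)
  open IsTotalOrder isTotalOrder public using (total; antisym)
    renaming ( reflexive to ≈⇒≤; refl to ≤-refl; trans to ≤-trans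
             ; ≲-respˡ-≈ to ≤-respˡ-≈; ≲-respʳ-≈ to ≤-respʳ-≈)
  open IntegerCoefficientSolver commutativeRing
  open SetoidReasoning setoid

  if-cong : ∀ b {X Y} → X ≈ Y → (if b then X else 0#) ≈ (if b then Y else 0#)
  if-cong true  X≈Y = X≈Y
  if-cong false X≈Y = refl

  sumF-++ : ∀ xs ys → sumF (xs ++ ys) ≈ sumF xs + sumF ys
  sumF-++ []       ys = sym (+-identityˡ _)
  sumF-++ (x ∷ xs) ys = trans (+-congˡ (sumF-++ xs ys)) (sym (+-assoc _ _ _))

  fromℕ-+ : ∀ m n → fromℕ (m Nat.+ n) ≈ fromℕ m + fromℕ n
  fromℕ-+ zero    n = sym (+-identityˡ _)
  fromℕ-+ (suc m) n = trans (+-congˡ (fromℕ-+ m n)) (sym (+-assoc _ _ _))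

  0<-respʳ-≈ : ∀ {a b} → 0# < a → a ≈ b → 0# < b
  0<-respʳ-≈ (0≤a , 0≉a) a≈b = ≤-respʳ-≈ a≈b 0≤a , λ 0≈b → 0≉a (trans 0≈b (sym a≈b))

  neg-nonneg : ∀ {a} → a ≤ 0# → 0# ≤ (- a)
  neg-nonneg {a} a≤0 = ≤-respˡ-≈ (-‿inverseʳ a) (≤-respʳ-≈ (+-identityˡ (- a)) (+-mono-≤ (- a) a≤0))

  neg-nonpos : ∀ {a} → 0# ≤ a → (- a) ≤ 0#
  neg-nonpos {a} 0≤a = ≤-respʳ-≈ (-‿inverseʳ a) (≤-respˡ-≈ (+-identityˡ (- a)) (+-mono-≤ (- a) 0≤a))

  -- If 1 ≤ 0, then 1 = (−1)(−1) ≥ 0 all the same.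
  0≤1 : 0# ≤ 1#
  0≤1 with total 0# 1#
  ... | inj₁ 0≤1 = 0≤1
  ... | inj₂ 1≤0 = ≤-respʳ-≈ (solve 0 (:- lit 1 :* :- lit 1 := lit 1) refl)
                             (*-nonneg (neg-nonneg 1≤0) (neg-nonneg 1≤0))

  0<1 : 0# < 1#
  0<1 = 0≤1 , 0≉1

  +-nonneg : ∀ {a b} → 0# ≤ a → 0# ≤ b → 0# ≤ (a + b)
  +-nonneg {a} {b} 0≤a 0≤b = ≤-trans 0≤b (≤-respˡ-≈ (+-identityˡ b) (+-mono-≤ b 0≤a))

  +-pos-nonneg : ∀ {a b} → 0# < a → 0# ≤ b → 0# < (a + b)
  +-pos-nonneg {a} {b} (0≤a , 0≉a) 0≤b = +-nonneg 0≤a 0≤b , λ 0≈a+b → 0≉a (antisym 0≤a (a≤0 0≈a+b))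
    where
    a≤0 : 0# ≈ a + b → a ≤ 0#
    a≤0 0≈a+b = ≤-respˡ-≈ (sym a≈-b) (neg-nonpos 0≤b)
      where
      a≈-b : a ≈ - b
      a≈-b = begin
        a             ≈⟨ solve 2 (λ a b → a := (a :+ b) :- b) refl a b ⟩
        (a + b) - b   ≈⟨ +-congʳ 0≈a+b ⟨
        0# - b        ≈⟨ +-identityˡ (- b) ⟩
        - b           ∎

  *-pos : ∀ {a b} → 0# < a → 0# < b → 0# < (a * b)
  *-pos {a} {b} (0≤a , 0≉a) (0≤b , 0≉b) = *-nonneg 0≤a 0≤b , λ 0≈ab → 0≉b (sym (b≈0 0≈ab))
    where
    b≈0 : 0# ≈ a * b → b ≈ 0#
    b≈0 0≈ab with inverse a (λ a≈0 → 0≉a (sym a≈0))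
    ... | a⁻¹ , aa⁻¹≈1 = begin
      b                ≈⟨ *-identityˡ b ⟨
      1# * b           ≈⟨ *-congʳ aa⁻¹≈1 ⟨
      (a * a⁻¹) * b    ≈⟨ solve 3 (λ a a⁻¹ b → (a :* a⁻¹) :* b := a⁻¹ :* (a :* b)) refl a a⁻¹ b ⟩
      a⁻¹ * (a * b)    ≈⟨ *-congˡ 0≈ab ⟨
      a⁻¹ * 0#         ≈⟨ zeroʳ a⁻¹ ⟩
      0#               ∎

  <⇒0<- : ∀ {a b} → a < b → 0# < (b - a)
  <⇒0<- {a} {b} (a≤b , a≉b) =
    ≤-respˡ-≈ (-‿inverseʳ a) (+-mono-≤ (- a) a≤b) , λ 0≈b-a → a≉b (sym (b≈a 0≈b-a))
    where
    b≈a : 0# ≈ b - a → b ≈ a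
    b≈a 0≈b-a = begin
      b              ≈⟨ solve 2 (λ a b → b := (b :- a) :+ a) refl a b ⟩
      (b - a) + a    ≈⟨ +-congʳ 0≈b-a ⟨
      0# + a         ≈⟨ +-identityˡ a ⟩
      a              ∎

  fromℕ-nonneg : ∀ m → 0# ≤ (fromℕ m)
  fromℕ-nonneg zero    = ≤-refl
  fromℕ-nonneg (suc m) = +-nonneg 0≤1 (fromℕ-nonneg m)

  fromℕ-pos : ∀ m → 0# < (fromℕ (suc m))
  fromℕ-pos m = +-pos-nonneg 0<1 (fromℕ-nonneg m)

module IndependentSets (G : Graph) where
  open Graph G

  Loopless : Set
  Loopless = ∀ v → adj v v ≡ false

  Apart : V → V → Set
  Apart u w = adj u w ≡ false × adj w u ≡ false

  everything : V → Bool
  everything _ = true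

  _∖_ : (V → Bool) → V → V → Bool
  (ω ∖ x) y = ω y ∧ (not (adj x y) ∧ not (adj y x))

  adjacent⇒removed : ∀ ω x y → adj x y ≡ true → (ω ∖ x) y ≡ false
  adjacent⇒removed ω x y x~y rewrite x~y = ∧-zeroʳ (ω y)

  apart⇒kept : ∀ ω x y → Apart x y → (ω ∖ x) y ≡ ω y
  apart⇒kept ω x y (x≁y , y≁x) rewrite x≁y | y≁x = ∧-identityʳ (ω y)

  admissible : (V → Bool) → List V → Bool
  admissible ω S = allB ω S ∧ independent G S

  admissible-∷ : Loopless → ∀ ω x S → admissible ω (x ∷ S) ≡ ω x ∧ admissible (ω ∖ x) S
  admissible-∷ loopless ω x S rewrite loopless x = begin
    (ω x ∧ allB ω S) ∧ (allB x≁ S ∧ allB (λ u → ≁x u ∧ allB (λ w → not (adj u w)) S) S)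
      ≡⟨ cong (λ b → (ω x ∧ allB ω S) ∧ (allB x≁ S ∧ b)) (allB-∧ ≁x _ S) ⟩
    (ω x ∧ allB ω S) ∧ (allB x≁ S ∧ (allB ≁x S ∧ independent G S))
      ≡⟨ ∧-assoc (ω x) _ _ ⟩
    ω x ∧ (allB ω S ∧ (allB x≁ S ∧ (allB ≁x S ∧ independent G S)))
      ≡⟨ cong (λ b → ω x ∧ (allB ω S ∧ b)) (∧-assoc (allB x≁ S) _ _) ⟨
    ω x ∧ (allB ω S ∧ ((allB x≁ S ∧ allB ≁x S) ∧ independent G S))
      ≡⟨ cong (ω x ∧_) (∧-assoc (allB ω S) _ _) ⟨
    ω x ∧ ((allB ω S ∧ (allB x≁ S ∧ allB ≁x S)) ∧ independent G S)
      ≡⟨ cong (λ b → ω x ∧ (b ∧ independent G S)) allB-∖ ⟨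
    ω x ∧ admissible (ω ∖ x) S ∎
    where
    open ≡.≡-Reasoning
    x≁ ≁x : V → Bool
    x≁ y = not (adj x y)
    ≁x y = not (adj y x)
    allB-∖ : allB (ω ∖ x) S ≡ allB ω S ∧ (allB x≁ S ∧ allB ≁x S)
    allB-∖ = ≡.trans (allB-∧ ω _ S) (cong (allB ω S ∧_) (allB-∧ x≁ ≁x S))

-- Ind ω L is the independence polynomial, in the variable t, of the subgraph
-- induced on the vertices of L allowed by ω: the first vertex x of L is either
-- left out, or put into the independent set, which forbids its neighbours.
module VertexElimination (F : OrderedField) (G : Graph) (t : OrderedField.Carrier F) where
  open OrderedField F hiding (zero)
  open OrderedFieldProperties F using (if-cong; sumF-++)
  open IntegerCoefficientSolver commutativeRing
  open SetoidReasoning setoid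
  open Graph G
  open IndependentSets G

  Ind : (V → Bool) → List V → Carrier
  Ind ω []      = 1#
  Ind ω (x ∷ L) = Ind ω L + (if ω x then t * Ind (ω ∖ x) L else 0#)

  Ind-cong : ∀ {ω ω′} L → All (λ y → ω y ≡ ω′ y) L → Ind ω L ≈ Ind ω′ L
  Ind-cong []      []                  = refl
  Ind-cong {ω} {ω′} (x ∷ L) (ωx≡ω′x ∷ eqs) rewrite ωx≡ω′x =
    +-cong (Ind-cong L eqs) (if-cong (ω′ x) (*-congˡ (Ind-cong L (All.map (cong (_∧ _)) eqs))))

  Ind-skip : ∀ {ω} C R → All (λ y → ω y ≡ false) C → Ind ω (C ++ R) ≈ Ind ω R
  Ind-skip []      R []                = refl
  Ind-skip (c ∷ C) R (ωc≡false ∷ offs) rewrite ωc≡false = trans (+-identityʳ _) (Ind-skip C R offs)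

  Ind-∷-cong : ∀ x {L L′} → (∀ ω → Ind ω L ≈ Ind ω L′) → ∀ ω → Ind ω (x ∷ L) ≈ Ind ω (x ∷ L′)
  Ind-∷-cong x L≈L′ ω = +-cong (L≈L′ ω) (if-cong (ω x) (*-congˡ (L≈L′ (ω ∖ x))))

  private
    exchange : ∀ a b {c c′} → c ≡ c′ → ∀ z A B {C C′} → C ≈ C′ →
      (z + (if b then t * A else 0#)) + (if a then t * (B + (if b ∧ c then t * C else 0#)) else 0#)
        ≈ (z + (if a then t * B else 0#)) + (if b then t * (A + (if a ∧ c′ then t * C′ else 0#)) else 0#)
    exchange false false c≡c′ z A B C≈C′ = refl
    exchange true  false c≡c′ z A B C≈C′ =
      solve 3 (λ z t B → (z :+ lit 0) :+ t :* (B :+ lit 0) := (z :+ t :* B) :+ lit 0) refl z t B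
    exchange false true  c≡c′ z A B C≈C′ =
      solve 3 (λ z t A → (z :+ t :* A) :+ lit 0 := (z :+ lit 0) :+ t :* (A :+ lit 0)) refl z t A
    exchange true  true  {c} ≡.refl z A B {C} {C′} C≈C′ = begin
      (z + t * A) + t * (B + W)    ≈⟨ solve 5 (λ z t A B W → (z :+ t :* A) :+ t :* (B :+ W)
                                                          := (z :+ t :* B) :+ t :* (A :+ W)) refl z t A B W ⟩
      (z + t * B) + t * (A + W)    ≈⟨ +-congˡ (*-congˡ (+-congˡ (if-cong c (*-congˡ C≈C′)))) ⟩
      (z + t * B) + t * (A + W′)   ∎
      where
      W W′ : Carrier
      W  = if c then t * C else 0#
      W′ = if c then t * C′ else 0#

  Ind-swap : ∀ ω x y L → Ind ω (x ∷ y ∷ L) ≈ Ind ω (y ∷ x ∷ L)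
  Ind-swap ω x y L =
    exchange (ω x) (ω y) (∧-comm (not (adj x y)) (not (adj y x)))
             (Ind ω L) (Ind (ω ∖ y) L) (Ind (ω ∖ x) L)
             (Ind-cong L (All.universal (λ z → ∧-xy∙z≈xz∙y (ω z) _ _) L))

  Ind-perm : ∀ ω {L L′} → L ↭ L′ → Ind ω L ≈ Ind ω L′
  Ind-perm ω ↭-refl                   = refl
  Ind-perm ω (prep {L} {L′} x L↭L′)   = Ind-∷-cong x {L} {L′} (λ ω′ → Ind-perm ω′ L↭L′) ω
  Ind-perm ω (swap {L} {L′} x y L↭L′) =
    trans (Ind-swap ω x y L)
          (Ind-∷-cong y {x ∷ L} {x ∷ L′} (Ind-∷-cong x {L} {L′} (λ ω′ → Ind-perm ω′ L↭L′)) ω)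
  Ind-perm ω (↭-trans L↭M M↭L′)        = trans (Ind-perm ω L↭M) (Ind-perm ω M↭L′)

  Ind-clique : ∀ C R → AllPairs (λ u w → adj u w ≡ true) C → All (λ c → All (Apart c) R) C →
               Ind everything (C ++ R) ≈ (1# + fromℕ (length C) * t) * Ind everything R
  Ind-clique []      R []           []            =
    solve 2 (λ Z t → Z := (lit 1 :+ lit 0 :* t) :* Z) refl (Ind everything R) t
  Ind-clique (c ∷ C) R (c~C ∷ clique) (c≁R ∷ apart) = begin
    Ind everything (C ++ R) + t * Ind (everything ∖ c) (C ++ R)
      ≈⟨ +-cong (Ind-clique C R clique apart)
                (*-congˡ (trans (Ind-skip C R (All.map (adjacent⇒removed everything c _) c~C))
                                (Ind-cong R (All.map (apart⇒kept everything c _) c≁R)))) ⟩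
    (1# + m * t) * Z + t * Z
      ≈⟨ solve 3 (λ m t Z → (lit 1 :+ m :* t) :* Z :+ t :* Z := (lit 1 :+ (lit 1 :+ m) :* t) :* Z) refl m t Z ⟩
    (1# + (1# + m) * t) * Z ∎
    where
    m = fromℕ (length C)
    Z = Ind everything R

  weight : List V → Carrier
  weight S = pow t (length S)

  sumWhere : (List V → Bool) → List (List V) → Carrier
  sumWhere p A = sumF (map weight (filterᵇ p A))

  sumWhere-++ : ∀ p A B → sumWhere p (A ++ B) ≈ sumWhere p A + sumWhere p B
  sumWhere-++ p A B
    rewrite filter-++ (T? ∘ p) A B | map-++ weight (filterᵇ p A) (filterᵇ p B) =
      sumF-++ (map weight (filterᵇ p A)) (map weight (filterᵇ p B))

  sumWhere-map-∷ : ∀ p x A → sumWhere p (map (x ∷_) A) ≈ t * sumWhere (λ S → p (x ∷ S)) A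
  sumWhere-map-∷ p x []      = sym (zeroʳ t)
  sumWhere-map-∷ p x (S ∷ A) with p (x ∷ S)
  ... | true  = trans (+-congˡ (sumWhere-map-∷ p x A)) (sym (distribˡ t _ _))
  ... | false = sumWhere-map-∷ p x A

  sumWhere-cong : ∀ {p q} → (∀ S → p S ≡ q S) → ∀ A → sumWhere p A ≡ sumWhere q A
  sumWhere-cong {p} {q} p≗q A = cong (sumF ∘ map weight) (filter-≐ (T? ∘ p) (T? ∘ q) p≐q A)
    where
    p≐q : (T ∘ p) ≐ (T ∘ q)
    p≐q = (λ {S} → ≡.subst T (p≗q S)) , (λ {S} → ≡.subst T (≡.sym (p≗q S)))

  sumWhere-none : ∀ A → sumWhere (λ _ → false) A ≈ 0#
  sumWhere-none []      = refl
  sumWhere-none (S ∷ A) = sumWhere-none A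

  sumWhere-guard : ∀ b q A → t * sumWhere (λ S → b ∧ q S) A ≈ (if b then t * sumWhere q A else 0#)
  sumWhere-guard true  q A = refl
  sumWhere-guard false q A = trans (*-congˡ (sumWhere-none A)) (zeroʳ t)

  sumWhere-admissible : Loopless → ∀ ω L → sumWhere (admissible ω) (sublists L) ≈ Ind ω L
  sumWhere-admissible loopless ω []      = +-identityʳ 1#
  sumWhere-admissible loopless ω (x ∷ L) = begin
    sumWhere (admissible ω) (sublists L ++ map (x ∷_) (sublists L))
      ≈⟨ sumWhere-++ _ (sublists L) _ ⟩
    sumWhere (admissible ω) (sublists L) + sumWhere (admissible ω) (map (x ∷_) (sublists L))
      ≈⟨ +-cong (sumWhere-admissible loopless ω L) (sumWhere-map-∷ _ x (sublists L)) ⟩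
    Ind ω L + t * sumWhere (λ S → admissible ω (x ∷ S)) (sublists L)
      ≡⟨ cong (λ s → Ind ω L + t * s) (sumWhere-cong (admissible-∷ loopless ω x) (sublists L)) ⟩
    Ind ω L + t * sumWhere (λ S → ω x ∧ admissible (ω ∖ x) S) (sublists L)
      ≈⟨ +-congˡ (sumWhere-guard (ω x) _ (sublists L)) ⟩
    Ind ω L + (if ω x then t * sumWhere (admissible (ω ∖ x)) (sublists L) else 0#)
      ≈⟨ +-congˡ (if-cong (ω x) (*-congˡ (sumWhere-admissible loopless (ω ∖ x) L))) ⟩
    Ind ω L + (if ω x then t * Ind (ω ∖ x) L else 0#) ∎

  sumWhere-independent : Loopless → ∀ L → sumWhere (independent G) (sublists L) ≈ Ind everything L
  sumWhere-independent loopless L = begin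
    sumWhere (independent G) (sublists L)          ≡⟨ sumWhere-cong independent≡admissible (sublists L) ⟩
    sumWhere (admissible everything) (sublists L)  ≈⟨ sumWhere-admissible loopless everything L ⟩
    Ind everything L                               ∎
    where
    independent≡admissible : ∀ S → independent G S ≡ admissible everything S
    independent≡admissible S = cong (_∧ independent G S) (≡.sym (allB-true S))

-- P ss is the independence polynomial, in t, of the clique extension of a path
-- whose clique sizes, read along the path, are ss; Q ss is the same with the
-- first path vertex deleted.
module CliquePathRecurrence (F : OrderedField) (t : OrderedField.Carrier F) where
  open OrderedField F hiding (zero)
  open OrderedFieldProperties F

  α : ℕ → Carrier
  α s = 1# + fromℕ (s ∸ 1) * t

  P Q : List ℕ → Carrier
  P []       = 1#
  P (s ∷ ss) = α s * P ss + t * Q ss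
  Q []       = 1#
  Q (s ∷ ss) = α s * P ss

  P-pos : 0# ≤ t → ∀ ss → (0# < P ss) × (0# < Q ss)
  P-pos 0≤t []       = 0<1 , 0<1
  P-pos 0≤t (s ∷ ss) = +-pos-nonneg 0<αP (*-nonneg 0≤t (proj₁ 0<Q)) , 0<αP
    where
    0<P = proj₁ (P-pos 0≤t ss)
    0<Q = proj₂ (P-pos 0≤t ss)
    0<αP : 0# < (α s * P ss)
    0<αP = *-pos (+-pos-nonneg 0<1 (*-nonneg (fromℕ-nonneg (s ∸ 1)) 0≤t)) 0<P

module CliqueExtendedPath (n : ℕ) (a : Fin n → ℕ) where
  open Nat using (_≤_; _<_)

  G : Graph
  G = cliqueExt n (pathAdj n) a

  open Graph G
  open IndependentSets G

  pos : V → ℕ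
  pos (inj₁ i)       = toℕ i
  pos (inj₂ (i , _)) = toℕ i

  loopless : Loopless
  loopless (inj₁ i)       rewrite ≡ᵇ-false (1+n≢n {toℕ i}) = ≡.refl
  loopless (inj₂ (i , p)) rewrite ≡ᵇ-true (toℕ i) | ≡ᵇ-true (toℕ p) = ≡.refl

  clique-apart : ∀ {i p} y → toℕ i ≢ pos y → Apart (inj₂ (i , p)) y
  clique-apart (inj₁ j)       i≢j = ≡ᵇ-false i≢j , ≡ᵇ-false (≢-sym i≢j)
  clique-apart (inj₂ (j , q)) i≢j rewrite ≡ᵇ-false i≢j | ≡ᵇ-false (≢-sym i≢j) = ≡.refl , ≡.refl

  path-clique-apart : ∀ {i j q} → toℕ i ≢ toℕ j → Apart (inj₁ i) (inj₂ (j , q))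
  path-clique-apart i≢j = ≡ᵇ-false i≢j , ≡ᵇ-false (≢-sym i≢j)

  path-apart : ∀ {i} y → suc (suc (toℕ i)) ≤ pos y → Apart (inj₁ i) y
  path-apart (inj₁ j) 2+i≤j
    rewrite ≡ᵇ-false (<⇒≢ 2+i≤j) | ≡ᵇ-false (≢-sym (<⇒≢ (m<n⇒m<1+n (<⇒≤ 2+i≤j)))) = ≡.refl , ≡.refl
  path-apart {i} (inj₂ (j , q)) 2+i≤j = path-clique-apart {i} {j} {q} (<⇒≢ (<⇒≤ 2+i≤j))

  path-adjacent : ∀ {i j} → toℕ j ≡ suc (toℕ i) → adj (inj₁ i) (inj₁ j) ≡ true
  path-adjacent {i} j≡1+i rewrite j≡1+i | ≡ᵇ-true (suc (toℕ i)) = ≡.refl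

  path-clique-adjacent : ∀ i p → adj (inj₁ i) (inj₂ (i , p)) ≡ true
  path-clique-adjacent i p = ≡ᵇ-true (toℕ i)

  clique-adjacent : ∀ i {p q} → p ≢ q → adj (inj₂ (i , p)) (inj₂ (i , q)) ≡ true
  clique-adjacent i p≢q rewrite ≡ᵇ-true (toℕ i) | ≡ᵇ-false (p≢q ∘ toℕ-injective) = ≡.refl

  clique : Fin n → List V
  clique i = map (λ p → inj₂ (i , p)) (allFin (a i ∸ 1))

  clique-pairwise-adjacent : ∀ i → AllPairs (λ u w → adj u w ≡ true) (clique i)
  clique-pairwise-adjacent i = AllPairs.map⁺ (AllPairs.map (clique-adjacent i) (allFin⁺ (a i ∸ 1)))

  length-clique : ∀ i → length (clique i) ≡ a i ∸ 1
  length-clique i = ≡.trans (length-map _ (allFin (a i ∸ 1))) (length-tabulate id)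

  blocks : List (Fin n) → List V
  blocks []       = []
  blocks (i ∷ is) = inj₁ i ∷ clique i ++ blocks is

  vertices↭blocks : ∀ is → map inj₁ is ++ concatMap clique is ↭ blocks is
  vertices↭blocks []       = ↭-refl
  vertices↭blocks (i ∷ is) =
    prep (inj₁ i) (↭-trans (shifts (map inj₁ is) (clique i)) (++⁺ˡ (clique i) (vertices↭blocks is)))

  data Consecutive : ℕ → List (Fin n) → Set where
    []  : ∀ {d} → Consecutive d []
    _∷_ : ∀ {d i is} → toℕ i ≡ d → Consecutive (suc d) is → Consecutive d (i ∷ is)

  tabulate-consecutive : ∀ {m} d (f : Fin m → Fin n) →
                         (∀ j → toℕ (f j) ≡ d Nat.+ toℕ j) → Consecutive d (tabulate f)
  tabulate-consecutive {zero}  d f f≡d+ = []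
  tabulate-consecutive {suc m} d f f≡d+ =
    ≡.trans (f≡d+ zero) (ℕₚ.+-identityʳ d)
      ∷ tabulate-consecutive (suc d) (f ∘ suc) (λ j → ≡.trans (f≡d+ (suc j)) (ℕₚ.+-suc d (toℕ j)))

  allFin-consecutive : Consecutive 0 (allFin n)
  allFin-consecutive = tabulate-consecutive 0 id (λ _ → ≡.refl)

  blocks-beyond : ∀ {d is} → Consecutive d is → All (λ y → d ≤ pos y) (blocks is)
  blocks-beyond []             = []
  blocks-beyond (i≡d ∷ consec) =
    ≤-reflexive (≡.sym i≡d)
      ∷ ++⁺ (map⁺ (All.universal (λ _ → ≤-reflexive (≡.sym i≡d)) _)) (All.map <⇒≤ (blocks-beyond consec))

  module _ (F : OrderedField) (t : OrderedField.Carrier F) where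
    open OrderedField F hiding (zero; _≤_; _<_)
    open VertexElimination F G t
    open CliquePathRecurrence F t
    open SetoidReasoning setoid

    Ind-clique-++ : ∀ {d} i {is} → toℕ i ≡ d → Consecutive (suc d) is →
                    Ind everything (clique i ++ blocks is) ≈ α (a i) * Ind everything (blocks is)
    Ind-clique-++ i {is} ≡.refl consec = begin
      Ind everything (clique i ++ blocks is)
        ≈⟨ Ind-clique (clique i) (blocks is) (clique-pairwise-adjacent i)
                      (map⁺ (All.universal (λ _ → apart-beyond) _)) ⟩
      (1# + fromℕ (length (clique i)) * t) * Ind everything (blocks is)
        ≡⟨ cong (λ m → (1# + fromℕ m * t) * Ind everything (blocks is)) (length-clique i) ⟩
      α (a i) * Ind everything (blocks is) ∎
      where
      apart-beyond : ∀ {p} → All (Apart (inj₂ (i , p))) (blocks is)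
      apart-beyond = All.map (λ {y} i<y → clique-apart y (<⇒≢ i<y)) (blocks-beyond consec)

    Ind-blocks : ∀ {d is} → Consecutive d is → Ind everything (blocks is) ≈ P (map a is)
    Ind-blocks-after : ∀ {i is} → Consecutive (suc (toℕ i)) is →
                       Ind (everything ∖ inj₁ i) (blocks is) ≈ Q (map a is)

    Ind-blocks []                           = refl
    Ind-blocks {is = i ∷ is} (≡.refl ∷ consec) = +-cong
      (trans (Ind-clique-++ i ≡.refl consec) (*-congˡ (Ind-blocks consec)))
      (*-congˡ (trans (Ind-skip {everything ∖ inj₁ i} (clique i) (blocks is)
                                (map⁺ (All.universal clique-removed _)))
                      (Ind-blocks-after consec)))
      where
      clique-removed : ∀ p → (everything ∖ inj₁ i) (inj₂ (i , p)) ≡ false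
      clique-removed p = adjacent⇒removed everything (inj₁ i) (inj₂ (i , p)) (path-clique-adjacent i p)

    Ind-blocks-after []                             = refl
    Ind-blocks-after {i} {j ∷ js} (j≡1+i ∷ consec) = begin
      Ind ω (inj₁ j ∷ clique j ++ blocks js)
        ≈⟨ Ind-skip {ω} [ inj₁ j ] (clique j ++ blocks js)
                    (adjacent⇒removed everything (inj₁ i) (inj₁ j) (path-adjacent j≡1+i) ∷ []) ⟩
      Ind ω (clique j ++ blocks js)
        ≈⟨ Ind-cong {ω} {everything} (clique j ++ blocks js)
                    (++⁺ (map⁺ (All.universal clique-kept _))
                         (All.map (λ {y} → blocks-kept {y}) (blocks-beyond consec))) ⟩
      Ind everything (clique j ++ blocks js)
        ≈⟨ Ind-clique-++ j j≡1+i consec ⟩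
      α (a j) * Ind everything (blocks js)
        ≈⟨ *-congˡ (Ind-blocks consec) ⟩
      α (a j) * P (map a js) ∎
      where
      ω = everything ∖ inj₁ i
      i≢j : toℕ i ≢ toℕ j
      i≢j i≡j = 1+n≢n (≡.trans (≡.sym j≡1+i) (≡.sym i≡j))
      clique-kept : ∀ q → ω (inj₂ (j , q)) ≡ true
      clique-kept q = apart⇒kept everything (inj₁ i) (inj₂ (j , q)) (path-clique-apart {q = q} i≢j)
      blocks-kept : ∀ {y} → suc (suc (toℕ i)) ≤ pos y → ω y ≡ true
      blocks-kept {y} 2+i≤y = apart⇒kept everything (inj₁ i) y (path-apart y 2+i≤y)

    sumWhere-independent≈P : sumWhere (independent G) (sublists vertices) ≈ P (map a (allFin n))
    sumWhere-independent≈P = begin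
      sumWhere (independent G) (sublists vertices) ≈⟨ sumWhere-independent loopless vertices ⟩
      Ind everything vertices                      ≈⟨ Ind-perm everything (vertices↭blocks (allFin n)) ⟩
      Ind everything (blocks (allFin n))           ≈⟨ Ind-blocks allFin-consecutive ⟩
      P (map a (allFin n))                         ∎

  U≈P : ∀ F x → let open OrderedField F in U F G x ≈ CliquePathRecurrence.P F (- x) (map a (allFin n))
  -- U F G x unfolds to sumWhere (independent G) (sublists vertices) at t = − x.
  U≈P F x = sumWhere-independent≈P F (OrderedField.-_ F x)

tailSizes : ℕ → ℕ → List ℕ
tailSizes k m = replicate m (k Nat.+ 1) ++ [ k Nat.+ 3 ]

sizesG-allFin : ∀ m k → map (sizesG (suc (suc m)) k) (allFin (suc (suc m))) ≡ k Nat.+ 3 ∷ tailSizes k m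
sizesG-allFin m k =
  ≡.trans (map-tabulate id (sizesG (suc (suc m)) k))
          (cong (k Nat.+ 3 ∷_) (tabulate-replicate-∷ʳ m (sizesG (suc (suc m)) k ∘ suc) inner last))
  where
  inner : ∀ j → toℕ j Nat.< m → sizesG (suc (suc m)) k (suc j) ≡ k Nat.+ 1
  inner j j<m rewrite ≡ᵇ-false (<⇒≢ j<m) = ≡.refl
  last : sizesG (suc (suc m)) k (suc (Fin.fromℕ m)) ≡ k Nat.+ 3
  last rewrite toℕ-fromℕ m | ≡ᵇ-true m = ≡.refl

module PositiveRoots (F : OrderedField) (k : ℕ) (x : OrderedField.Carrier F) where
  open OrderedField F hiding (zero)
  open OrderedFieldProperties F
  open CliquePathRecurrence F (- x)
  open IntegerCoefficientSolver commutativeRing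
  open SetoidReasoning setoid

  K : Carrier
  K = fromℕ k

  D : Carrier
  D = 1# - (K + fromℕ 4) * x

  E : List ℕ → Carrier
  E ss = (P ss + P ss) - Q ss

  -- Solver terms for fromℕ m (unlike lit m, with the trailing 0#), α (k + 1),
  -- α (k + 3), D and E.
  :fromℕ : ∀ {v} → ℕ → Polynomial v
  :fromℕ zero    = lit 0
  :fromℕ (suc m) = lit 1 :+ :fromℕ m

  :α-mid :α-end :D :E : ∀ {v} → Polynomial v → Polynomial v → Polynomial v
  :α-mid K x = lit 1 :+ K :* (:- x)
  :α-end K x = lit 1 :+ (K :+ :fromℕ 2) :* (:- x)
  :D     K x = lit 1 :- (K :+ :fromℕ 4) :* x
  :E     p q = (p :+ p) :- q

  α-mid : α (k Nat.+ 1) ≈ 1# + K * (- x)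
  α-mid = reflexive (cong (λ c → 1# + fromℕ c * (- x)) (ℕₚ.m+n∸n≡m k 1))

  α-end : α (k Nat.+ 3) ≈ 1# + (K + fromℕ 2) * (- x)
  α-end = +-congˡ (*-congʳ (trans (reflexive (cong fromℕ k+3∸1≡k+2)) (fromℕ-+ k 2)))
    where
    k+3∸1≡k+2 : k Nat.+ 3 ∸ 1 ≡ k Nat.+ 2
    k+3∸1≡k+2 = ℕₚ.+-∸-assoc k {3} {1} (s≤s z≤n)

  P-last : P [ k Nat.+ 3 ] ≈ x + D
  P-last = begin
    α (k Nat.+ 3) * 1# + (- x) * 1#                 ≈⟨ +-congʳ (*-congʳ α-end) ⟩
    (1# + (K + fromℕ 2) * (- x)) * 1# + (- x) * 1#  ≈⟨ solve 2 (λ K x → :α-end K x :* lit 1 :+ (:- x) :* lit 1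
                                                                 := x :+ :D K x) refl K x ⟩
    x + D                                           ∎

  E-last : E [ k Nat.+ 3 ] ≈ D
  E-last = begin
    (P [ k Nat.+ 3 ] + P [ k Nat.+ 3 ]) - α (k Nat.+ 3) * 1#
      ≈⟨ +-cong (+-cong P-last P-last) (-‿cong (*-congʳ α-end)) ⟩
    ((x + D) + (x + D)) - (1# + (K + fromℕ 2) * (- x)) * 1#
      ≈⟨ solve 2 (λ K x → ((x :+ :D K x) :+ (x :+ :D K x)) :- :α-end K x :* lit 1 := :D K x) refl K x ⟩
    D ∎

  P-mid : ∀ ss → P (k Nat.+ 1 ∷ ss) ≈ (D + (x + x)) * P ss + x * E ss
  P-mid ss = begin
    α (k Nat.+ 1) * p + (- x) * q      ≈⟨ +-congʳ (*-congʳ α-mid) ⟩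
    (1# + K * (- x)) * p + (- x) * q   ≈⟨ solve 4 (λ K x p q → :α-mid K x :* p :+ (:- x) :* q
                                                     := (:D K x :+ (x :+ x)) :* p :+ x :* :E p q) refl K x p q ⟩
    (D + (x + x)) * p + x * E ss       ∎
    where
    p = P ss
    q = Q ss

  E-mid : ∀ ss → E (k Nat.+ 1 ∷ ss) ≈ D * P ss + (x + x) * E ss
  E-mid ss = begin
    (P (k Nat.+ 1 ∷ ss) + P (k Nat.+ 1 ∷ ss)) - α (k Nat.+ 1) * p
      ≈⟨ +-cong (+-cong (P-mid ss) (P-mid ss)) (-‿cong (*-congʳ α-mid)) ⟩
    (((D + (x + x)) * p + x * E ss) + ((D + (x + x)) * p + x * E ss)) - (1# + K * (- x)) * p
      ≈⟨ solve 4 (λ K x p q → ((:D K x :+ (x :+ x)) :* p :+ x :* :E p q)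
                               :+ ((:D K x :+ (x :+ x)) :* p :+ x :* :E p q)
                               :- :α-mid K x :* p
                             := :D K x :* p :+ (x :+ x) :* :E p q) refl K x p q ⟩
    D * p + (x + x) * E ss ∎
    where
    p = P ss
    q = Q ss

  P-first : ∀ ss → P (k Nat.+ 3 ∷ ss) ≈ D * P ss + x * E ss
  P-first ss = begin
    α (k Nat.+ 3) * p + (- x) * q                 ≈⟨ +-congʳ (*-congʳ α-end) ⟩
    (1# + (K + fromℕ 2) * (- x)) * p + (- x) * q  ≈⟨ solve 4 (λ K x p q → :α-end K x :* p :+ (:- x) :* q
                                                                := :D K x :* p :+ x :* :E p q) refl K x p q ⟩
    D * p + x * E ss                              ∎
    where
    p = P ss
    q = Q ss

  private
    vanishing : ∀ c p → 0# * p + c * 0# ≈ 0#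
    vanishing = solve 2 (λ c p → lit 0 :* p :+ c :* lit 0 := lit 0) refl

  E-tail-root : D ≈ 0# → ∀ m → E (tailSizes k m) ≈ 0#
  E-tail-root D≈0 zero    = trans E-last D≈0
  E-tail-root D≈0 (suc m) = begin
    E (tailSizes k (suc m))                           ≈⟨ E-mid (tailSizes k m) ⟩
    D * P (tailSizes k m) + (x + x) * E (tailSizes k m) ≈⟨ +-cong (*-congʳ D≈0) (*-congˡ (E-tail-root D≈0 m)) ⟩
    0# * P (tailSizes k m) + (x + x) * 0#              ≈⟨ vanishing (x + x) _ ⟩
    0#                                                ∎

  tail-pos : 0# < x → 0# < D → ∀ m → (0# < P (tailSizes k m)) × (0# ≤ E (tailSizes k m))
  tail-pos 0<x 0<D zero    =
    0<-respʳ-≈ (+-pos-nonneg 0<x (proj₁ 0<D)) (sym P-last) , ≤-respʳ-≈ (sym E-last) (proj₁ 0<D)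
  tail-pos 0<x 0<D (suc m) =
      0<-respʳ-≈ (+-pos-nonneg (*-pos (+-pos-nonneg 0<D 0≤x+x) 0<P) (*-nonneg 0≤x 0≤E))
                 (sym (P-mid (tailSizes k m)))
    , ≤-respʳ-≈ (sym (E-mid (tailSizes k m)))
                (+-nonneg (*-nonneg (proj₁ 0<D) (proj₁ 0<P)) (*-nonneg 0≤x+x 0≤E))
    where
    0≤x = proj₁ 0<x
    0≤x+x = +-nonneg 0≤x 0≤x
    0<P = proj₁ (tail-pos 0<x 0<D m)
    0≤E = proj₂ (tail-pos 0<x 0<D m)

  path-root : D ≈ 0# → ∀ m → P (k Nat.+ 3 ∷ tailSizes k m) ≈ 0#
  path-root D≈0 m = begin
    P (k Nat.+ 3 ∷ tailSizes k m)                ≈⟨ P-first (tailSizes k m) ⟩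
    D * P (tailSizes k m) + x * E (tailSizes k m) ≈⟨ +-cong (*-congʳ D≈0) (*-congˡ (E-tail-root D≈0 m)) ⟩
    0# * P (tailSizes k m) + x * 0#              ≈⟨ vanishing x _ ⟩
    0#                                          ∎

  path-pos : 0# < x → 0# < D → ∀ m → 0# < P (k Nat.+ 3 ∷ tailSizes k m)
  path-pos 0<x 0<D m =
    0<-respʳ-≈ (+-pos-nonneg (*-pos 0<D 0<P) (*-nonneg (proj₁ 0<x) 0≤E)) (sym (P-first (tailSizes k m)))
    where
    0<P = proj₁ (tail-pos 0<x 0<D m)
    0≤E = proj₂ (tail-pos 0<x 0<D m)

  D≈ : ∀ r → r * fromℕ (k Nat.+ 4) ≈ 1# → D ≈ (r - x) * fromℕ (k Nat.+ 4)
  D≈ r rN≈1 = begin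
    1# - (K + fromℕ 4) * x   ≈⟨ +-cong (sym rN≈1) (-‿cong (*-congʳ (sym (fromℕ-+ k 4)))) ⟩
    r * N - N * x            ≈⟨ solve 3 (λ r x N → r :* N :- N :* x := (r :- x) :* N) refl r x N ⟩
    (r - x) * N              ∎
    where
    N = fromℕ (k Nat.+ 4)

  fromℕ-k+4-pos : 0# < fromℕ (k Nat.+ 4)
  fromℕ-k+4-pos = 0<-respʳ-≈ (fromℕ-pos (k Nat.+ 3)) (reflexive (cong fromℕ (≡.sym (ℕₚ.+-suc k 3))))

module MainArgument (F : OrderedField) (m k : ℕ) where
  open OrderedField F hiding (zero)
  open OrderedFieldProperties F
  open IntegerCoefficientSolver commutativeRing
  module Roots = PositiveRoots F k

  G : Graph
  G = Gn (suc (suc m)) k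

  U≈P : ∀ x → U F G x ≈ CliquePathRecurrence.P F (- x) (k Nat.+ 3 ∷ tailSizes k m)
  U≈P x = trans (CliqueExtendedPath.U≈P (suc (suc m)) (sizesG (suc (suc m)) k) F x)
                (reflexive (cong (CliquePathRecurrence.P F (- x)) (sizesG-allFin m k)))

  nonpositive-not-root : ∀ {x} → x ≤ 0# → ¬ (U F G x ≈ 0#)
  nonpositive-not-root {x} x≤0 Ux≈0 =
    proj₂ (proj₁ (CliquePathRecurrence.P-pos F (- x) (neg-nonneg x≤0) (k Nat.+ 3 ∷ tailSizes k m)))
          (trans (sym Ux≈0) (U≈P x))

  roots-positive : ∀ x → U F G x ≈ 0# → 0# < x
  roots-positive x Ux≈0 with total x 0#
  ... | inj₁ x≤0 = ⊥-elim (nonpositive-not-root x≤0 Ux≈0)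
  ... | inj₂ 0≤x = 0≤x , λ 0≈x → nonpositive-not-root (≈⇒≤ (sym 0≈x)) Ux≈0

  smallest-root : ∀ r → r * fromℕ (k Nat.+ 4) ≈ 1# →
                  (U F G r ≈ 0#) × (∀ x → 0# < x → x < r → ¬ (U F G x ≈ 0#))
  smallest-root r rN≈1 = trans (U≈P r) (Roots.path-root r D≈0 m) , no-smaller-root
    where
    D≈0 : Roots.D r ≈ 0#
    D≈0 = trans (Roots.D≈ r r rN≈1) (solve 2 (λ r N → (r :- r) :* N := lit 0) refl r (fromℕ (k Nat.+ 4)))
    no-smaller-root : ∀ x → 0# < x → x < r → ¬ (U F G x ≈ 0#)
    no-smaller-root x 0<x x<r Ux≈0 = proj₂ (Roots.path-pos x 0<x 0<D m) (trans (sym Ux≈0) (U≈P x))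
      where
      0<D : 0# < Roots.D x
      0<D = 0<-respʳ-≈ (*-pos (<⇒0<- x<r) (Roots.fromℕ-k+4-pos x)) (sym (Roots.D≈ x r rN≈1))

open import Data.Nat using (_≤_)
import Data.Nat

theorem5p6 : (F : OrderedField) (n k : ℕ) → 2 ≤ n → 1 ≤ k →
    let open OrderedField F in
      (∀ x → U F (Gn n k) x ≈ 0# → 0# < x)
      × (∀ r → r * fromℕ (k Data.Nat.+ 4) ≈ 1# →
           (U F (Gn n k) r ≈ 0#)
           × (∀ x → 0# < x → x < r → ¬ (U F (Gn n k) x ≈ 0#)))
theorem5p6 F (suc (suc m)) k (s≤s (s≤s z≤n)) _ =
  MainArgument.roots-positive F m k , MainArgument.smallest-root F m k
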